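{- Let $R$ be an inp-minimal integral domain with maximal ideal $\mathfrak M$. If $R$ contains an infinite set $F$ such that $F-F\subseteq R^\times\cup\{0\}$, then $R$ is a valuation ring. In particular: (1) if $R/\mathfrak M$ is infinite then $R$ is a valuation ring; (2) if $R$ has an infinite subring which is a field then $R$ is a valuation ring.
   Context: Inp-minimality refers to the structure $(R;+,\cdot,0,1)$. $R^\times$ is the group of units and $F-F=\{x-y\mid x,y\in F\}$. -}

module Defs where

open import Level using (Level; _⊔_; Lift; lift)
open import Algebra.Bundles using (CommutativeRing)
open import Data.Nat using (ℕ; suc)
open import Data.Fin using (Fin)
open import Data.Vec.Functional using (Vector; _∷_)
open import Data.Product using (Σ; ∃; _×_; _,_)
open import Data.Sum using (_⊎_)
open import Data.Empty using (⊥)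
open import Data.List using (List)
open import Data.List.Relation.Unary.All using (All)
open import Relation.Nullary using (¬_)
open import Relation.Unary using (Pred)
open import Relation.Binary.PropositionalEquality using (_≡_)
open import Function.Definitions using (Injective)

-- First-order logic in the language of rings (+, ·, 0, 1).
-- Variables are de Bruijn indices in Fin n.

data Term (n : ℕ) : Set where
  var  : Fin n → Term n
  `0 `1 : Term n
  _`+_ _`*_ : Term n → Term n → Term n

data Formula : ℕ → Set where
  _`≈_ : ∀ {n} → Term n → Term n → Formula n
  `¬_  : ∀ {n} → Formula n → Formula n
  _`∧_ : ∀ {n} → Formula n → Formula n → Formula n
  `∃_  : ∀ {n} → Formula (suc n) → Formula n

module Semantics {c ℓ : Level} (R : CommutativeRing c ℓ) where
  open CommutativeRing R

  eval : ∀ {n} → Term n → Vector Carrier n → Carrier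
  eval (var i)   ρ = ρ i
  eval `0        ρ = 0#
  eval `1        ρ = 1#
  eval (t `+ s)  ρ = eval t ρ + eval s ρ
  eval (t `* s)  ρ = eval t ρ * eval s ρ

  Sat : ∀ {n} → Formula n → Vector Carrier n → Set (c ⊔ ℓ)
  Sat (t `≈ s) ρ = Lift c (eval t ρ ≈ eval s ρ)
  Sat (`¬ φ)   ρ = Sat φ ρ → ⊥
  Sat (φ `∧ ψ) ρ = Sat φ ρ × Sat ψ ρ
  Sat (`∃ φ)   ρ = Σ Carrier λ x → Sat φ (x ∷ ρ)

  -- A partitioned formula φ(x; ȳ) with x a single object variable (index
  -- zero) and m parameter variables; its instance at parameter tuple a.
  Inst : ∀ {m} → Formula (suc m) → Vector Carrier m → Pred Carrier (c ⊔ ℓ)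
  Inst φ a x = Sat φ (x ∷ a)

  KInconsistent : ∀ {m N} → Formula (suc m) → ℕ → (Fin N → Vector Carrier m) → Set (c ⊔ ℓ)
  KInconsistent {N = N} φ k a =
    (s : Fin k → Fin N) → Injective _≡_ _≡_ s →
    ¬ (Σ Carrier λ x → ∀ t → Inst φ (a (s t)) x)

  -- Finite approximation of size N of an inp-pattern of depth 2 in the
  -- single variable x, with formulas φ₁, φ₂ and bounds k₁, k₂, realised in R.
  InpPattern2Approx : ∀ {m₁ m₂} → Formula (suc m₁) → Formula (suc m₂) → ℕ → ℕ → ℕ → Set (c ⊔ ℓ)
  InpPattern2Approx {m₁} {m₂} φ₁ φ₂ k₁ k₂ N =
    Σ (Fin N → Vector Carrier m₁) λ a₁ →
    Σ (Fin N → Vector Carrier m₂) λ a₂ →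
      KInconsistent φ₁ k₁ a₁ × KInconsistent φ₂ k₂ a₂ ×
      (∀ j₁ j₂ → Σ Carrier λ x → Inst φ₁ (a₁ j₁) x × Inst φ₂ (a₂ j₂) x)

  -- Th(R) has an inp-pattern of depth 2 in one variable (by compactness:
  -- arbitrarily large finite approximations exist in R itself).
  HasInpPattern2 : Set (c ⊔ ℓ)
  HasInpPattern2 =
    Σ ℕ λ m₁ → Σ ℕ λ m₂ → Σ (Formula (suc m₁)) λ φ₁ → Σ (Formula (suc m₂)) λ φ₂ →
    Σ ℕ λ k₁ → Σ ℕ λ k₂ → ∀ N → InpPattern2Approx φ₁ φ₂ k₁ k₂ N

-- inp-minimal: burden of Th(R) in one variable is at most 1.
InpMinimal : ∀ {c ℓ} → CommutativeRing c ℓ → Set (c ⊔ ℓ)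
InpMinimal R = ¬ Semantics.HasInpPattern2 R

module _ {c ℓ : Level} (R : CommutativeRing c ℓ) where
  open CommutativeRing R

  IsUnit : Pred Carrier (c ⊔ ℓ)
  IsUnit x = Σ Carrier λ y → x * y ≈ 1#

  IsIntegralDomain : Set (c ⊔ ℓ)
  IsIntegralDomain = (¬ 1# ≈ 0#) × (∀ x y → x * y ≈ 0# → x ≈ 0# ⊎ y ≈ 0#)

  -- the non-units form an ideal (the unique maximal ideal 𝔐)
  𝔐 : Pred Carrier (c ⊔ ℓ)
  𝔐 x = ¬ IsUnit x

  IsLocal : Set (c ⊔ ℓ)
  IsLocal = ∀ x y → 𝔐 x → 𝔐 y → 𝔐 (x + y)

  _∣_ : Carrier → Carrier → Set (c ⊔ ℓ)
  a ∣ b = Σ Carrier λ d → b ≈ a * d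

  -- a domain is a valuation ring iff its principal ideals are totally ordered
  IsValuationRing : Set (c ⊔ ℓ)
  IsValuationRing = ∀ a b → a ∣ b ⊎ b ∣ a

  Infinite : ∀ {p} → Pred Carrier p → Set (c ⊔ ℓ ⊔ p)
  Infinite F = (l : List Carrier) → Σ Carrier λ x → F x × All (λ y → ¬ x ≈ y) l

  -- R/𝔐 is infinite: no finite list of residue classes exhausts R/𝔐.
  ResidueFieldInfinite : Set (c ⊔ ℓ)
  ResidueFieldInfinite =
    (l : List Carrier) → Σ Carrier λ x → All (λ y → ¬ 𝔐 (x - y)) l

  DiffsUnitsOrZero : ∀ {p} → Pred Carrier p → Set (c ⊔ ℓ ⊔ p)
  DiffsUnitsOrZero F = ∀ x y → F x → F y → IsUnit (x - y) ⊎ (x - y) ≈ 0#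

  IsSubfield : ∀ {p} → Pred Carrier p → Set (c ⊔ ℓ ⊔ p)
  IsSubfield S =
    S 0# × S 1# ×
    (∀ x y → S x → S y → S (x + y)) ×
    (∀ x → S x → S (- x)) ×
    (∀ x y → S x → S y → S (x * y)) ×
    (∀ x → S x → ¬ x ≈ 0# → Σ Carrier λ y → S y × x * y ≈ 1#)

module Submission where

-- Suppose R contains elements e₀, e₁, e₂, … such that
-- e n - e m is a unit whenever m < n.  If a ∤ b, the cosets e_i b + aR are
-- pairwise disjoint: from e_i b + a z ≈ e_j b + a z' we get
-- (e_i - e_j) b ∈ aR, and e_i - e_j is a unit, so a ∣ b.  Hence, if neither
-- a ∣ b nor b ∣ a, the two rows of formulas  x ∈ e_i b + aR  and  x ∈ e_j a + bR
-- are 2-inconsistent, while every pair of paths meets in e_i b + e_j a: an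
-- inp-pattern of depth 2, contradicting inp-minimality.  So R is a valuation
-- ring (excluded middle decides a ∣ b).

open import Defs
open import Level using (Level; _⊔_; Lift; lift; lower)
open import Algebra.Bundles using (CommutativeRing)
open import Axiom.ExcludedMiddle using (ExcludedMiddle)
open import Data.Product using (_×_; Σ; _,_; proj₁; proj₂)
open import Relation.Unary using (Pred)
open import Data.Nat using (ℕ; zero; suc; _<_; s≤s)
open import Data.Nat.Properties using (m≤n⇒m<n∨m≡n; <-cmp)
open import Data.Fin using (Fin; toℕ) renaming (zero to fzero; suc to fsuc)
open import Data.Fin.Properties using (toℕ-injective)
open import Data.Vec.Functional using (Vector) renaming (_∷_ to _∷ᵥ_; [] to []ᵥ)
open import Data.Sum using (_⊎_; inj₁; inj₂)
open import Data.Empty using (⊥-elim)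
open import Data.Unit.Polymorphic using (⊤)
open import Data.List using (List; []; _∷_)
open import Data.List.Relation.Unary.All as All using (All; _∷_)
open import Relation.Nullary using (¬_; yes; no)
open import Relation.Nullary.Decidable using (map′)
open import Relation.Binary.PropositionalEquality using () renaming (refl to ≡-refl)
open import Relation.Binary.Definitions using (tri<; tri≈; tri>)
import Algebra.Solver.Ring.NaturalCoefficients.Default as NatSolver
import Algebra.Properties.Ring as RingProperties
import Algebra.Properties.Group as GroupProperties
import Relation.Binary.Reasoning.Setoid as SetoidReasoning

lowerEM : ∀ {a} b → ExcludedMiddle (a ⊔ b) → ExcludedMiddle a
lowerEM b em {P} = map′ lower lift (em {Lift b P})

module Enumeration {a p q : Level} {A : Set a} (P : Pred A p) (Q : A → A → Set q)
                   (next : (l : List A) → Σ A λ x → P x × All (Q x) l) where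

  prefix : ℕ → List A
  enum : ℕ → A
  prefix zero    = []
  prefix (suc n) = enum n ∷ prefix n
  enum n = proj₁ (next (prefix n))

  lookup-prefix : ∀ {x} n m → m < n → All (Q x) (prefix n) → Q x (enum m)
  lookup-prefix (suc n) m (s≤s m≤n) (q ∷ qs) with m≤n⇒m<n∨m≡n m≤n
  ... | inj₁ m<n  = lookup-prefix n m m<n qs
  ... | inj₂ ≡-refl = q

  enum-P : ∀ n → P (enum n)
  enum-P n = proj₁ (proj₂ (next (prefix n)))

  enum-Q : ∀ m n → m < n → Q (enum n) (enum m)
  enum-Q m n m<n = lookup-prefix n m m<n (proj₂ (proj₂ (next (prefix n))))

module _ {c ℓ : Level} (R : CommutativeRing c ℓ) where
  open CommutativeRing R
  open Semantics R

  UnitSeparated : (ℕ → Carrier) → Set (c ⊔ ℓ)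
  UnitSeparated e = ∀ m n → m < n → IsUnit R (e n - e m)

  open SetoidReasoning setoid
  open NatSolver commutativeSemiring using (solve; _:+_; _:=_)
  open RingProperties ring using (x[y-z]≈xy-xz; [y-z]x≈yx-zx)

  transpose : ∀ p q r s → p + q ≈ r + s → p - r ≈ s - q
  transpose p q r s h = begin
    p - r                     ≈⟨ sym (+-identityʳ _) ⟩
    (p - r) + 0#              ≈⟨ +-congˡ (sym (-‿inverseʳ q)) ⟩
    (p - r) + (q - q)         ≈⟨ solve 6 (λ p q r s nq nr → (p :+ nr) :+ (q :+ nq) := (p :+ q) :+ (nr :+ nq)) refl p q r s (- q) (- r) ⟩
    (p + q) + (- r + - q)     ≈⟨ +-congʳ h ⟩
    (r + s) + (- r + - q)     ≈⟨ solve 6 (λ p q r s nq nr → (r :+ s) :+ (nr :+ nq) := (s :+ nq) :+ (r :+ nr)) refl p q r s (- q) (- r) ⟩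
    (s - q) + (r - r)         ≈⟨ +-congˡ (-‿inverseʳ r) ⟩
    (s - q) + 0#              ≈⟨ +-identityʳ _ ⟩
    s - q                     ∎

  coset-overlap⇒∣ : ∀ a b x f f' z z' u →
                    x ≈ f * b + a * z → x ≈ f' * b + a * z' →
                    (f - f') * u ≈ 1# → _∣_ R a b
  coset-overlap⇒∣ a b x f f' z z' u hx hx' hu = (z' - z) * u , (begin
    b                          ≈⟨ sym (*-identityʳ b) ⟩
    b * 1#                     ≈⟨ *-congˡ (sym hu) ⟩
    b * ((f - f') * u)         ≈⟨ sym (*-assoc _ _ _) ⟩
    (b * (f - f')) * u         ≈⟨ *-congʳ (*-comm _ _) ⟩
    ((f - f') * b) * u         ≈⟨ *-congʳ ([y-z]x≈yx-zx b f f') ⟩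
    (f * b - f' * b) * u       ≈⟨ *-congʳ (transpose _ _ _ _ (trans (sym hx) hx')) ⟩
    (a * z' - a * z) * u       ≈⟨ *-congʳ (sym (x[y-z]≈xy-xz a z' z)) ⟩
    (a * (z' - z)) * u         ≈⟨ *-assoc _ _ _ ⟩
    a * ((z' - z) * u)         ∎)

  -- The formula  inCoset(x; y, z) := ∃ w. x = y + z·w,  i.e. x ∈ y + zR.
  inCoset : Formula 3
  inCoset = `∃ (var (fsuc fzero) `≈ (var (fsuc (fsuc fzero)) `+ (var (fsuc (fsuc (fsuc fzero))) `* var fzero)))

  -- Parameters of the coset e_j b + aR.
  cosetRow : (ℕ → Carrier) → Carrier → Carrier → ∀ {N} → Fin N → Vector Carrier 2
  cosetRow e a b j = (e (toℕ j) * b) ∷ᵥ a ∷ᵥ []ᵥ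

  cosetRow-2-inconsistent : ∀ e → UnitSeparated e → ∀ {N} a b → ¬ _∣_ R a b →
                            KInconsistent {N = N} inCoset 2 (cosetRow e a b)
  cosetRow-2-inconsistent e sep a b a∤b s s-inj (x , sat)
    with <-cmp (toℕ (s fzero)) (toℕ (s (fsuc fzero))) | sat fzero | sat (fsuc fzero)
  ... | tri< lt _ _ | z , lift hx | z' , lift hx' =
    a∤b (coset-overlap⇒∣ a b x _ _ z' z _ hx' hx (proj₂ (sep _ _ lt)))
  ... | tri≈ _ eq _ | _ | _ with s-inj (toℕ-injective eq)
  ...   | ()
  cosetRow-2-inconsistent e sep a b a∤b s s-inj (x , sat)
      | tri> _ _ gt | z , lift hx | z' , lift hx' =
    a∤b (coset-overlap⇒∣ a b x _ _ z z' _ hx hx' (proj₂ (sep _ _ gt)))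

  -- Two mutually non-dividing elements yield an inp-pattern of depth 2: the
  -- path (i, j) is realised by e_i b + e_j a.
  incomparable⇒inpPattern : ∀ e → UnitSeparated e → ∀ a b →
                            ¬ _∣_ R a b → ¬ _∣_ R b a → HasInpPattern2
  incomparable⇒inpPattern e sep a b a∤b b∤a = 2 , 2 , inCoset , inCoset , 2 , 2 , λ N →
    cosetRow e a b , cosetRow e b a ,
    cosetRow-2-inconsistent e sep a b a∤b , cosetRow-2-inconsistent e sep b a b∤a ,
    λ i j → (e (toℕ i) * b + e (toℕ j) * a) ,
      (e (toℕ j) , lift (+-congˡ (*-comm _ _))) ,
      (e (toℕ i) , lift (trans (+-comm _ _) (+-congˡ (*-comm _ _))))

  unitSeparated⇒valuation : ExcludedMiddle (c ⊔ ℓ) → InpMinimal R →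
                            ∀ e → UnitSeparated e → IsValuationRing R
  unitSeparated⇒valuation em inp e sep a b with em {_∣_ R a b} | em {_∣_ R b a}
  ... | yes a∣b | _       = inj₁ a∣b
  ... | no _    | yes b∣a = inj₂ b∣a
  ... | no a∤b  | no b∤a  = ⊥-elim (inp (incomparable⇒inpPattern e sep a b a∤b b∤a))

  -- An infinite set whose distinct elements differ by units contains a
  -- unit-separated sequence.
  infinite-separated⇒valuation : ∀ {p} → ExcludedMiddle (c ⊔ ℓ) → InpMinimal R →
                                 (F : Pred Carrier p) → Infinite R F →
                                 (∀ x y → F x → F y → ¬ x ≈ y → IsUnit R (x - y)) →
                                 IsValuationRing R
  infinite-separated⇒valuation em inp F inf sep =
    unitSeparated⇒valuation em inp E.enum
      (λ m n m<n → sep _ _ (E.enum-P n) (E.enum-P m) (E.enum-Q m n m<n))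
    where module E = Enumeration F (λ x y → ¬ x ≈ y) inf

  x-y≈0⇒x≈y : ∀ x y → x - y ≈ 0# → x ≈ y
  x-y≈0⇒x≈y = GroupProperties.x∙y⁻¹≈ε⇒x≈y (Algebra.Bundles.AbelianGroup.group +-abelianGroup)

  diffsUnitsOrZero⇒separated : ∀ {p} (F : Pred Carrier p) → DiffsUnitsOrZero R F →
                               ∀ x y → F x → F y → ¬ x ≈ y → IsUnit R (x - y)
  diffsUnitsOrZero⇒separated F diffs x y fx fy x≉y with diffs x y fx fy
  ... | inj₁ unit = unit
  ... | inj₂ x-y≈0 = ⊥-elim (x≉y (x-y≈0⇒x≈y x y x-y≈0))

  -- In a subfield, distinct elements differ by a nonzero element of the
  -- subfield, which is invertible.
  subfield⇒separated : ∀ {p} (S : Pred Carrier p) → IsSubfield R S →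
                       ∀ x y → S x → S y → ¬ x ≈ y → IsUnit R (x - y)
  subfield⇒separated S (_ , _ , S-+ , S-neg , _ , S-inv) x y sx sy x≉y
    with S-inv (x - y) (S-+ x (- y) sx (S-neg y sy)) (λ x-y≈0 → x≉y (x-y≈0⇒x≈y x y x-y≈0))
  ... | w , _ , inverse = w , inverse

  -- An infinite residue field gives a sequence of elements pairwise
  -- incongruent modulo 𝔐, i.e. differing by units (classically).
  residueFieldInfinite⇒unitSeparated : ExcludedMiddle (c ⊔ ℓ) → ResidueFieldInfinite R →
                                       Σ (ℕ → Carrier) UnitSeparated
  residueFieldInfinite⇒unitSeparated em res = E.enum , λ m n m<n → E.enum-Q m n m<n
    where
    nonMaximal⇒unit : ∀ {z} → ¬ 𝔐 R z → IsUnit R z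
    nonMaximal⇒unit {z} z∉𝔐 with em {IsUnit R z}
    ... | yes unit   = unit
    ... | no nonunit = ⊥-elim (z∉𝔐 nonunit)

    module E = Enumeration (λ _ → ⊤ {c ⊔ ℓ}) (λ x y → IsUnit R (x - y))
                 (λ l → proj₁ (res l) , _ , All.map nonMaximal⇒unit (proj₂ (res l)))

lemma3p6 : ∀ {c ℓ} (p : Level) → ExcludedMiddle (c ⊔ ℓ ⊔ p) →
           (R : CommutativeRing c ℓ) →
           IsIntegralDomain R → IsLocal R → InpMinimal R →
           ((F : Pred (CommutativeRing.Carrier R) p) →
              Infinite R F → DiffsUnitsOrZero R F → IsValuationRing R)
           × (ResidueFieldInfinite R → IsValuationRing R)
           × ((S : Pred (CommutativeRing.Carrier R) p) →
              IsSubfield R S → Infinite R S → IsValuationRing R)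
lemma3p6 p em R _ _ inp =
  (λ F inf diffs → infinite-separated⇒valuation R em′ inp F inf
                     (diffsUnitsOrZero⇒separated R F diffs)) ,
  (λ res → let (e , sep) = residueFieldInfinite⇒unitSeparated R em′ res
           in unitSeparated⇒valuation R em′ inp e sep) ,
  (λ S subfield inf → infinite-separated⇒valuation R em′ inp S inf
                        (subfield⇒separated R S subfield))
  where em′ = lowerEM p em
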